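{- Let $X$ be a finite set with $|X|\ge 3$, and let $\mathcal T$ be a triplet cover for a binary phylogenetic $X$-tree $T$. Then $|\mathcal T|\ge 2|X|-3$. Moreover, this bound is tight: for every binary phylogenetic $X$-tree $T$ there exists a triplet cover of $T$ of cardinality $2|X|-3$.
   Context: A binary phylogenetic $X$-tree is an unrooted tree whose leaf set is $X$ and in which every non-leaf (interior) vertex has degree $3$. For $\mathcal T\subseteq\binom{X}{2}$ and an interior vertex $v$, a triple $\{a,b,c\}\subseteq X$ supports $v$ if $a,b,c$ lie one in each of the three components of $T$ minus $v$ and $\{a,b\},\{a,c\},\{b,c\}\in\mathcal T$. $\mathcal T$ is a triplet cover for $T$ if every interior vertex is supported by some triple. -}

module Defs where

open import Data.Nat using (ℕ; zero; suc; _+_; _≤_)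
open import Data.Fin using (Fin) renaming (_<_ to _<ᶠ_)
open import Data.Fin.Properties using ()
open import Data.Bool using (Bool; true; false; if_then_else_; T)
open import Data.Sum using (_⊎_; inj₁; inj₂)
open import Data.Product using (_×_; _,_; proj₁; proj₂; Σ; ∃; ∃-syntax)
open import Data.Unit using (⊤)
open import Data.Empty using (⊥)
open import Data.List using (List; []; _∷_; _++_; map; length; allFin; _∷ʳ_)
open import Data.Nat.ListAction using (sum)
open import Data.List.Relation.Unary.All using (All)
open import Data.List.Relation.Unary.Unique.Propositional using (Unique)
open import Data.List.Relation.Unary.Linked using (Linked)
open import Data.List.Membership.Propositional using (_∈_)
open import Relation.Binary.PropositionalEquality using (_≡_; _≢_)
open import Relation.Nullary using (¬_)

-- Vertices of a tree with leaf set X = Fin n and k interior vertices.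
Vtx : ℕ → ℕ → Set
Vtx n k = Fin n ⊎ Fin k

allVtx : (n k : ℕ) → List (Vtx n k)
allVtx n k = map inj₁ (allFin n) ++ map inj₂ (allFin k)

module _ {n k : ℕ} (adj : Vtx n k → Vtx n k → Bool) where

  Adj : Vtx n k → Vtx n k → Set
  Adj u v = T (adj u v)

  deg : Vtx n k → ℕ
  deg u = sum (map (λ w → if adj u w then 1 else 0) (allVtx n k))

  data Walk (ok : Vtx n k → Set) : Vtx n k → Vtx n k → Set where
    here : ∀ {u} → ok u → Walk ok u u
    step : ∀ {u w v} → ok u → Adj u w → Walk ok w v → Walk ok u v

  Connected : Set
  Connected = ∀ u v → Walk (λ _ → ⊤) u v

  IsCycle : Vtx n k → List (Vtx n k) → Set
  IsCycle v xs = (2 ≤ length xs) × Unique (v ∷ xs) × Linked Adj ((v ∷ xs) ∷ʳ v)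

  Acyclic : Set
  Acyclic = ∀ v xs → ¬ IsCycle v xs

  SameComp : Vtx n k → Vtx n k → Vtx n k → Set
  SameComp v u w = Walk (λ x → x ≢ v) u w

record BinPhyloTree (n k : ℕ) : Set where
  field
    adj       : Vtx n k → Vtx n k → Bool
    adj-sym   : ∀ u v → adj u v ≡ adj v u
    adj-irr   : ∀ v → adj v v ≡ false
    connected : Connected adj
    acyclic   : Acyclic adj
    leaf-deg  : ∀ x → deg adj (inj₁ x) ≡ 1
    int-deg   : ∀ i → deg adj (inj₂ i) ≡ 3

-- A set 𝒯 ⊆ (X choose 2), represented as a duplicate-free list of pairs (a , b)
-- with a < b, so that |𝒯| = length of the list.
record PairSet (n : ℕ) : Set where
  field
    pairs   : List (Fin n × Fin n)
    ordered : All (λ p → proj₁ p <ᶠ proj₂ p) pairs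
    unique  : Unique pairs

  card : ℕ
  card = length pairs

_∈ₚ_ : ∀ {n} → Fin n × Fin n → PairSet n → Set
(a , b) ∈ₚ 𝒯 = ((a , b) ∈ PairSet.pairs 𝒯) ⊎ ((b , a) ∈ PairSet.pairs 𝒯)

module _ {n k : ℕ} (Tr : BinPhyloTree n k) (𝒯 : PairSet n) where
  open BinPhyloTree Tr

  Supports : Fin n → Fin n → Fin n → Fin k → Set
  Supports a b c v =
    ¬ SameComp adj (inj₂ v) (inj₁ a) (inj₁ b) ×
    ¬ SameComp adj (inj₂ v) (inj₁ a) (inj₁ c) ×
    ¬ SameComp adj (inj₂ v) (inj₁ b) (inj₁ c) ×
    (a , b) ∈ₚ 𝒯 × (a , c) ∈ₚ 𝒯 × (b , c) ∈ₚ 𝒯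

  TripletCover : Set
  TripletCover = ∀ (v : Fin k) → ∃[ a ] ∃[ b ] ∃[ c ] Supports a b c v

module Submission where

-- Both bounds are proved by induction over subsets Y of the leaves, for covers of the vertices of
-- the subtree spanned by Y. That subtree has a cherry: a vertex u whose branches towards a and
-- towards b contain no other leaf of Y. Deleting a removes exactly the vertex u from the subtree,
-- and for every other vertex a and b lie in the same branch. Lower bound: the triple supporting u
-- must be {a, b, c}; replacing a by b everywhere turns a cover of Y into a cover of Y - a, while
-- {a, b} becomes a loop and {a, c}, {b, c} merge, so at least two pairs are lost. Upper bound: a
-- cover of Y - a of size 2|Y| - 5 extends by {a, b} and {a, c}, with c any partner of b in it.

open import Defs
open import Data.Nat using (ℕ; zero; suc; pred; _+_; _*_; _∸_; _≤_; _<_; z≤n; s≤s)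
open import Data.Nat.Properties
  using (≤-reflexive; ≤-trans; ≤-antisym; m≤m+n; n≤1+n; *-suc; +-monoʳ-≤; m≤n+o⇒m∸n≤o; m+n∸m≡n; m+[n∸m]≡n;
         module ≤-Reasoning)
open import Data.Nat.ListAction using (sum)
open import Data.Nat.Induction using (<-wellFounded)
open import Induction.WellFounded using (Acc; acc)
open import Data.Bool using (true; false; T; if_then_else_)
open import Data.Fin using (Fin) renaming (_<_ to _<ᶠ_)
import Data.Fin.Properties as Fin
open import Data.Product using (_×_; _,_; proj₁; proj₂; Σ; ∃-syntax)
import Data.Product.Properties as Product
open import Data.Sum using (_⊎_; inj₁; inj₂)
import Data.Sum.Properties as Sum
open import Data.Unit using (⊤)
open import Data.Empty using (⊥; ⊥-elim)
open import Data.List using (List; []; _∷_; _∷ʳ_; length; map; filter; allFin)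
open import Data.List.Properties using (length-map; filter-notAll; length-tabulate)
open import Data.List.Relation.Unary.All as All using (All; []; _∷_)
open import Data.List.Relation.Unary.Any as Any using (here; there; any?)
open import Data.List.Relation.Unary.AllPairs using ([]; _∷_)
open import Data.List.Relation.Unary.Linked using (Linked; [-]; _∷_)
open import Data.List.Relation.Unary.Unique.Propositional using (Unique)
open import Data.List.Relation.Unary.Unique.Propositional.Properties using (filter⁺; map⁺; ++⁺; allFin⁺)
open import Data.List.Relation.Binary.Subset.Propositional using (_⊆_)
open import Data.List.Membership.Propositional using (_∈_; find; lose)
open import Data.List.Membership.Propositional.Properties
  using (∈-length; ∈-filter⁺; ∈-filter⁻; ∈-map⁺; ∈-map⁻; ∈-++⁺ˡ; ∈-++⁺ʳ; ∈-allFin)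
import Data.List.Membership.DecPropositional as DecMembership
open import Relation.Nullary using (¬_; yes; no)
open import Relation.Nullary.Decidable using (¬?; _⊎-dec_; _×-dec_; T?)
open import Relation.Unary using (Decidable)
open import Relation.Binary.Definitions using (DecidableEquality; tri<; tri≈; tri>)
open import Relation.Binary.PropositionalEquality using (_≡_; _≢_; refl; sym; trans; cong; subst; module ≡-Reasoning)

three-distinct : ∀ {A : Set} {xs : List A} → Unique xs → 3 ≤ length xs →
  ∃[ x ] ∃[ y ] ∃[ z ] (x ∈ xs × y ∈ xs × z ∈ xs) × x ≢ y × x ≢ z × y ≢ z
three-distinct {xs = x ∷ y ∷ z ∷ _} ((x≢y ∷ x≢z ∷ _) ∷ (y≢z ∷ _) ∷ _) _ =
  x , y , z , (here refl , there (here refl) , there (there (here refl))) , x≢y , x≢z , y≢z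
three-distinct {xs = []} _ ()
three-distinct {xs = _ ∷ []} _ (s≤s ())
three-distinct {xs = _ ∷ _ ∷ []} _ (s≤s (s≤s ()))

3≰2 : ¬ 3 ≤ 2
3≰2 (s≤s (s≤s ()))

double-suc-≤ : ∀ {y e e′} → 2 * y ≤ 3 + e′ → 2 + e′ ≤ e → 2 * suc y ≤ 3 + e
double-suc-≤ {y} {e} {e′} 2y≤ e′≤ = begin
  2 * suc y    ≡⟨ *-suc 2 y ⟩
  2 + 2 * y    ≤⟨ +-monoʳ-≤ 2 2y≤ ⟩
  3 + (2 + e′) ≤⟨ +-monoʳ-≤ 3 e′≤ ⟩
  3 + e        ∎
  where open ≤-Reasoning

nonempty-∈ : ∀ {A : Set} {xs : List A} {m} → length xs ≡ suc m → ∃[ x ] x ∈ xs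
nonempty-∈ {xs = x ∷ _} _ = x , here refl

length≡1⇒≡ : ∀ {A : Set} {xs : List A} {x y} → length xs ≡ 1 → x ∈ xs → y ∈ xs → x ≡ y
length≡1⇒≡ {xs = _ ∷ []} _ (here refl) (here refl) = refl

module DecidableLists {A : Set} (_≟_ : DecidableEquality A) where

  remove : A → List A → List A
  remove x = filter (λ y → ¬? (y ≟ x))

  module _ {x : A} {xs : List A} where

    ∈-remove⁺ : ∀ {y} → y ∈ xs → y ≢ x → y ∈ remove x xs
    ∈-remove⁺ = ∈-filter⁺ (λ y → ¬? (y ≟ x))

    ∈-remove⁻ : ∀ {y} → y ∈ remove x xs → y ∈ xs × y ≢ x
    ∈-remove⁻ = ∈-filter⁻ (λ y → ¬? (y ≟ x))

    remove⁺ : Unique xs → Unique (remove x xs)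
    remove⁺ = filter⁺ (λ y → ¬? (y ≟ x))

    length-remove< : x ∈ xs → length (remove x xs) < length xs
    length-remove< x∈xs = filter-notAll (λ y → ¬? (y ≟ x)) xs (Any.map (λ x≡y y≢x → y≢x (sym x≡y)) x∈xs)

    ⊆-∷-remove : xs ⊆ x ∷ remove x xs
    ⊆-∷-remove {y} y∈xs with y ≟ x
    ... | yes refl = here refl
    ... | no y≢x = there (∈-remove⁺ y∈xs y≢x)

  unique∧⊆⇒length≤ : ∀ {xs ys} → Unique xs → xs ⊆ ys → length xs ≤ length ys
  unique∧⊆⇒length≤ {[]} _ _ = z≤n
  unique∧⊆⇒length≤ {x ∷ xs} {ys} (x∉xs ∷ uxs) xs⊆ys =
    ≤-trans (s≤s (unique∧⊆⇒length≤ uxs xs⊆ys-x)) (length-remove< (xs⊆ys (here refl)))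
    where
    xs⊆ys-x : xs ⊆ remove x ys
    xs⊆ys-x y∈xs = ∈-remove⁺ (xs⊆ys (there y∈xs)) (λ y≡x → All.lookup x∉xs y∈xs (sym y≡x))

  length-remove : ∀ {x xs} → Unique xs → x ∈ xs → suc (length (remove x xs)) ≡ length xs
  length-remove uxs x∈xs = ≤-antisym (length-remove< x∈xs) (unique∧⊆⇒length≤ uxs ⊆-∷-remove)

  distinct-∈⇒3≤length : ∀ {x y z xs} → x ≢ y → x ≢ z → y ≢ z → x ∈ xs → y ∈ xs → z ∈ xs → 3 ≤ length xs
  distinct-∈⇒3≤length {x} {y} {z} {xs} x≢y x≢z y≢z x∈ y∈ z∈ =
    unique∧⊆⇒length≤ ((x≢y ∷ x≢z ∷ []) ∷ (y≢z ∷ []) ∷ [] ∷ []) ⊆xs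
    where
    ⊆xs : x ∷ y ∷ z ∷ [] ⊆ xs
    ⊆xs (here refl) = x∈
    ⊆xs (there (here refl)) = y∈
    ⊆xs (there (there (here refl))) = z∈

  avoiding-two : ∀ {xs} → Unique xs → 3 ≤ length xs → ∀ a b → ∃[ y ] y ∈ xs × y ≢ a × y ≢ b
  avoiding-two {xs} uxs 3≤ a b with any? (λ y → ¬? (y ≟ a) ×-dec ¬? (y ≟ b)) xs
  ... | yes found = find found
  ... | no ¬found = ⊥-elim (3≰2 (≤-trans 3≤ (unique∧⊆⇒length≤ uxs ⊆ab)))
    where
    ⊆ab : xs ⊆ a ∷ b ∷ []
    ⊆ab {y} y∈xs with y ≟ a | y ≟ b
    ... | yes y≡a | _ = here y≡a
    ... | no _ | yes y≡b = there (here y≡b)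
    ... | no y≢a | no y≢b = ⊥-elim (¬found (lose y∈xs (y≢a , y≢b)))

module Pairs (n : ℕ) where

  Pair : Set
  Pair = Fin n × Fin n

  _≟ᵖ_ : DecidableEquality Pair
  _≟ᵖ_ = Product.≡-dec Fin._≟_ Fin._≟_

  IsPair : Pair → Fin n → Fin n → Set
  IsPair p x y = p ≡ (x , y) ⊎ p ≡ (y , x)

  isPair? : ∀ x y → Decidable (λ p → IsPair p x y)
  isPair? x y p = (p ≟ᵖ (x , y)) ⊎-dec (p ≟ᵖ (y , x))

  IsPair-sym : ∀ {p x y} → IsPair p x y → IsPair p y x
  IsPair-sym (inj₁ e) = inj₂ e
  IsPair-sym (inj₂ e) = inj₁ e

  IsPair-unique : ∀ {p x y z} → IsPair p x y → IsPair p x z → y ≡ z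
  IsPair-unique (inj₁ refl) (inj₁ refl) = refl
  IsPair-unique (inj₁ refl) (inj₂ refl) = refl
  IsPair-unique (inj₂ refl) (inj₁ refl) = refl
  IsPair-unique (inj₂ refl) (inj₂ refl) = refl

  IsPair-∈ : ∀ {Z p x y} → IsPair p x y → x ∈ Z → y ∈ Z → proj₁ p ∈ Z × proj₂ p ∈ Z
  IsPair-∈ (inj₁ refl) x∈Z y∈Z = x∈Z , y∈Z
  IsPair-∈ (inj₂ refl) x∈Z y∈Z = y∈Z , x∈Z

  Edge : List Pair → Fin n → Fin n → Set
  Edge E x y = (x , y) ∈ E ⊎ (y , x) ∈ E

  Edge-sym : ∀ {E x y} → Edge E x y → Edge E y x
  Edge-sym (inj₁ m) = inj₂ m
  Edge-sym (inj₂ m) = inj₁ m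

  Edge-mono : ∀ {E F x y} → E ⊆ F → Edge E x y → Edge F x y
  Edge-mono E⊆F (inj₁ m) = inj₁ (E⊆F m)
  Edge-mono E⊆F (inj₂ m) = inj₂ (E⊆F m)

  Edge-witness : ∀ {E x y} → Edge E x y → ∃[ p ] p ∈ E × IsPair p x y
  Edge-witness (inj₁ m) = _ , m , inj₁ refl
  Edge-witness (inj₂ m) = _ , m , inj₂ refl

  Edge-isPair : ∀ {E p x y} → p ∈ E → IsPair p x y → Edge E x y
  Edge-isPair m (inj₁ refl) = inj₁ m
  Edge-isPair m (inj₂ refl) = inj₂ m

  Triangle : List Pair → Fin n → Fin n → Fin n → Set
  Triangle E x y z = Edge E x y × Edge E x z × Edge E y z

  Triangle-swap₁₂ : ∀ {E x y z} → Triangle E x y z → Triangle E y x z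
  Triangle-swap₁₂ (exy , exz , eyz) = Edge-sym exy , eyz , exz

  Triangle-swap₂₃ : ∀ {E x y z} → Triangle E x y z → Triangle E x z y
  Triangle-swap₂₃ (exy , exz , eyz) = exz , exy , Edge-sym eyz

  triangle-through : ∀ {E x y z a b} → Triangle E x y z → x ≢ y → x ≢ z → y ≢ z →
    a ∈ x ∷ y ∷ z ∷ [] → b ∈ x ∷ y ∷ z ∷ [] → a ≢ b → ∃[ c ] c ≢ a × c ≢ b × Triangle E a b c
  triangle-through t x≢y x≢z y≢z (here refl) (here refl) a≢b = ⊥-elim (a≢b refl)
  triangle-through t x≢y x≢z y≢z (here refl) (there (here refl)) _ =
    _ , (λ e → x≢z (sym e)) , (λ e → y≢z (sym e)) , t
  triangle-through t x≢y x≢z y≢z (here refl) (there (there (here refl))) _ =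
    _ , (λ e → x≢y (sym e)) , y≢z , Triangle-swap₂₃ t
  triangle-through t x≢y x≢z y≢z (there (here refl)) (here refl) _ =
    _ , (λ e → y≢z (sym e)) , (λ e → x≢z (sym e)) , Triangle-swap₁₂ t
  triangle-through t x≢y x≢z y≢z (there (here refl)) (there (here refl)) a≢b = ⊥-elim (a≢b refl)
  triangle-through t x≢y x≢z y≢z (there (here refl)) (there (there (here refl))) _ =
    _ , x≢y , x≢z , Triangle-swap₂₃ (Triangle-swap₁₂ t)
  triangle-through t x≢y x≢z y≢z (there (there (here refl))) (here refl) _ =
    _ , y≢z , (λ e → x≢y (sym e)) , Triangle-swap₁₂ (Triangle-swap₂₃ t)
  triangle-through t x≢y x≢z y≢z (there (there (here refl))) (there (here refl)) _ =
    _ , x≢z , x≢y , Triangle-swap₁₂ (Triangle-swap₂₃ (Triangle-swap₁₂ t))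
  triangle-through t x≢y x≢z y≢z (there (there (here refl))) (there (there (here refl))) a≢b = ⊥-elim (a≢b refl)

  mapPair : (Fin n → Fin n) → Pair → Pair
  mapPair f (x , y) = f x , f y

  Edge-map : ∀ f {E x y} → Edge E x y → Edge (map (mapPair f) E) (f x) (f y)
  Edge-map f (inj₁ m) = inj₁ (∈-map⁺ (mapPair f) m)
  Edge-map f (inj₂ m) = inj₂ (∈-map⁺ (mapPair f) m)

  removeEdge : Fin n → Fin n → List Pair → List Pair
  removeEdge x y = filter (λ p → ¬? (isPair? x y p))

  Edge-removeEdge : ∀ {E x y u v} → Edge E u v → ¬ IsPair (u , v) x y → Edge (removeEdge x y E) u v
  Edge-removeEdge {x = x} {y} (inj₁ m) ¬uv = inj₁ (∈-filter⁺ (λ p → ¬? (isPair? x y p)) m ¬uv)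
  Edge-removeEdge {x = x} {y} (inj₂ m) ¬uv =
    inj₂ (∈-filter⁺ (λ p → ¬? (isPair? x y p)) m (λ vu → ¬uv (swap vu)))
    where
    swap : ∀ {u v} → IsPair (v , u) x y → IsPair (u , v) x y
    swap (inj₁ refl) = inj₂ refl
    swap (inj₂ refl) = inj₁ refl

  length-removeEdge< : ∀ {E x y} → Edge E x y → length (removeEdge x y E) < length E
  length-removeEdge< {E} {x} {y} e with Edge-witness e
  ... | p , p∈E , isP = filter-notAll (λ p → ¬? (isPair? x y p)) E (Any.map (λ { refl ¬isP → ¬isP isP }) p∈E)

  dropLoops : List Pair → List Pair
  dropLoops = filter (λ p → ¬? (proj₁ p Fin.≟ proj₂ p))

  Edge-dropLoops : ∀ {E x y} → Edge E x y → x ≢ y → Edge (dropLoops E) x y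
  Edge-dropLoops (inj₁ m) x≢y = inj₁ (∈-filter⁺ (λ p → ¬? (proj₁ p Fin.≟ proj₂ p)) m x≢y)
  Edge-dropLoops (inj₂ m) x≢y =
    inj₂ (∈-filter⁺ (λ p → ¬? (proj₁ p Fin.≟ proj₂ p)) m (λ e → x≢y (sym e)))

  length-dropLoops< : ∀ {E x} → Edge E x x → length (dropLoops E) < length E
  length-dropLoops< {E} e with Edge-witness e
  ... | p , p∈E , isP =
    filter-notAll (λ p → ¬? (proj₁ p Fin.≟ proj₂ p)) E (Any.map (λ { refl ¬loop → ¬loop (loop isP) }) p∈E)
    where
    loop : ∀ {p x} → IsPair p x x → proj₁ p ≡ proj₂ p
    loop (inj₁ refl) = refl
    loop (inj₂ refl) = refl

  Ordered : Pair → Set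
  Ordered p = proj₁ p <ᶠ proj₂ p

  norm : Fin n → Fin n → Pair
  norm x y with x Fin.<? y
  ... | yes _ = x , y
  ... | no _ = y , x

  norm-isPair : ∀ x y → IsPair (norm x y) x y
  norm-isPair x y with x Fin.<? y
  ... | yes _ = inj₁ refl
  ... | no _ = inj₂ refl

  norm-ordered : ∀ {x y} → x ≢ y → Ordered (norm x y)
  norm-ordered {x} {y} x≢y with x Fin.<? y
  ... | yes x<y = x<y
  ... | no x≮y with Fin.<-cmp x y
  ... | tri< x<y _ _ = ⊥-elim (x≮y x<y)
  ... | tri≈ _ x≡y _ = ⊥-elim (x≢y x≡y)
  ... | tri> _ _ y<x = y<x

module _ {n k : ℕ} (Tr : BinPhyloTree n k) where
  open BinPhyloTree Tr
  open Pairs n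

  V : Set
  V = Vtx n k

  _≟ⱽ_ : DecidableEquality V
  _≟ⱽ_ = Sum.≡-dec Fin._≟_ Fin._≟_

  private module Lⱽ = DecidableLists _≟ⱽ_
  open DecidableLists (Fin._≟_ {n})

  A : V → V → Set
  A = Adj adj

  SC : V → V → V → Set
  SC = SameComp adj

  A-sym : ∀ {u v} → A u v → A v u
  A-sym {u} {v} = subst T (adj-sym u v)

  A-irrefl : ∀ {u v} → A u v → u ≢ v
  A-irrefl {u} a refl = subst T (adj-irr u) a

  module _ {ok : V → Set} where

    head-ok : ∀ {u v} → Walk adj ok u v → ok u
    head-ok (here o) = o
    head-ok (step o _ _) = o

    last-ok : ∀ {u v} → Walk adj ok u v → ok v
    last-ok (here o) = o
    last-ok (step _ _ r) = last-ok r

    _++ʷ_ : ∀ {u w v} → Walk adj ok u w → Walk adj ok w v → Walk adj ok u v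
    here _ ++ʷ q = q
    step o a r ++ʷ q = step o a (r ++ʷ q)

    reverseʷ : ∀ {u v} → Walk adj ok u v → Walk adj ok v u
    reverseʷ (here o) = here o
    reverseʷ (step o a r) = reverseʷ r ++ʷ step (head-ok r) (A-sym a) (here o)

    vertices : ∀ {u v} → Walk adj ok u v → List V
    vertices {u} (here _) = u ∷ []
    vertices {u} (step _ _ r) = u ∷ vertices r

    vertices-ok : ∀ {u v} (p : Walk adj ok u v) → All ok (vertices p)
    vertices-ok (here o) = o ∷ []
    vertices-ok (step o _ r) = o ∷ vertices-ok r

    Path : V → V → Set
    Path u v = Σ (Walk adj ok u v) (λ p → Unique (vertices p))

    suffix : ∀ {u v w} (p : Path u v) → w ∈ vertices (proj₁ p) → Path w v
    suffix (here o , up) (here refl) = here o , up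
    suffix (step o a r , up) (here refl) = step o a r , up
    suffix (step _ _ r , _ ∷ up) (there m) = suffix (r , up) m

    toPath : ∀ {u v} → Walk adj ok u v → Path u v
    toPath (here o) = here o , [] ∷ []
    toPath {u} (step o a r) with toPath r
    ... | r′ , ur′ with DecMembership._∈?_ _≟ⱽ_ u (vertices r′)
    ... | yes u∈r′ = suffix (r′ , ur′) u∈r′
    ... | no u∉r′ = step o a r′ , All.tabulate (λ m u≡ → u∉r′ (subst (_∈ vertices r′) (sym u≡) m)) ∷ ur′

    mapʷ : ∀ {ok′ : V → Set} {u v} → (∀ {x} → ok x → ok′ x) → Walk adj ok u v → Walk adj ok′ u v
    mapʷ f (here o) = here (f o)
    mapʷ f (step o a r) = step (f o) a (mapʷ f r)

  SC-refl : ∀ {v x} → x ≢ v → SC v x x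
  SC-refl = here

  SC-sym : ∀ {v x y} → SC v x y → SC v y x
  SC-sym = reverseʷ

  SC-trans : ∀ {v x y z} → SC v x y → SC v y z → SC v x z
  SC-trans = _++ʷ_

  SC-≢ : ∀ {v x y} → SC v x y → y ≢ v
  SC-≢ = last-ok

  neighbours-separated : ∀ {v w₁ w₂} → A v w₁ → A v w₂ → w₁ ≢ w₂ → ¬ SC v w₁ w₂
  neighbours-separated {v} {w₁} {w₂} a₁ a₂ w₁≢w₂ s with toPath s
  ... | here _ , _ = w₁≢w₂ refl
  ... | p@(step _ _ r) , up =
    acyclic v (vertices p)
      ( s≤s (nonempty r)
      , All.tabulate (λ m v≡ → All.lookup (vertices-ok p) m (sym v≡)) ∷ up
      , closes a₁ p )
    where
    nonempty : ∀ {u x} (q : Walk adj (_≢ v) u x) → 1 ≤ length (vertices q)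
    nonempty (here _) = s≤s z≤n
    nonempty (step _ _ _) = s≤s z≤n
    closes : ∀ {t u} → A t u → (q : Walk adj (_≢ v) u w₂) → Linked A (t ∷ (vertices q ∷ʳ v))
    closes a (here _) = a ∷ A-sym a₂ ∷ [-]
    closes a (step _ a′ q) = a ∷ closes a′ q

  enter : ∀ {x v} → Walk adj (λ _ → ⊤) x v → x ≢ v → ∃[ z ] A z v × SC v x z
  enter (here _) x≢v = ⊥-elim (x≢v refl)
  enter {x} {v} (step {w = y} _ a r) x≢v with y ≟ⱽ v
  ... | yes refl = x , a , here x≢v
  ... | no y≢v = let z , az , s = enter r y≢v in z , az , step x≢v a s

  sideOf : ∀ v x → x ≢ v → ∃[ z ] A v z × SC v z x
  sideOf v x x≢v = let z , az , s = enter (connected x v) x≢v in z , A-sym az , SC-sym s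

  sides-separated : ∀ {u z₁ z₂ x y} → A u z₁ → A u z₂ → z₁ ≢ z₂ → SC u z₁ x → SC u z₂ y → ¬ SC u x y
  sides-separated a₁ a₂ z₁≢z₂ s₁ s₂ sxy =
    neighbours-separated a₁ a₂ z₁≢z₂ (SC-trans s₁ (SC-trans sxy (SC-sym s₂)))

  avoid⊎reach : ∀ {ok u x} w → Walk adj ok u x → Walk adj (λ y → ok y × y ≢ w) u x ⊎ Walk adj ok u w
  avoid⊎reach {u = u} w p with u ≟ⱽ w
  ... | yes refl = inj₂ (here (head-ok p))
  avoid⊎reach w (here o) | no u≢w = inj₁ (here (o , u≢w))
  avoid⊎reach w (step o a r) | no u≢w with avoid⊎reach w r
  ... | inj₁ r′ = inj₁ (step (o , u≢w) a r′)
  ... | inj₂ r′ = inj₂ (step o a r′)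

  avoid⊎leave : ∀ {ok u x} w → Walk adj ok u x → x ≢ w →
    Walk adj (λ y → ok y × y ≢ w) u x ⊎ ∃[ z ] A w z × Walk adj (λ y → ok y × y ≢ w) z x
  avoid⊎leave w (here o) x≢w = inj₁ (here (o , x≢w))
  avoid⊎leave {u = u} w (step {w = z} o a r) x≢w with avoid⊎leave w r x≢w | u ≟ⱽ w
  ... | inj₂ left | _ = inj₂ left
  ... | inj₁ r′ | yes refl = inj₂ (z , a , r′)
  ... | inj₁ r′ | no u≢w = inj₁ (step (o , u≢w) a r′)

  SC-across : ∀ {u z z′ w x} → A u z → A u z′ → z ≢ z′ → SC u z w → SC u z′ x → SC w u x
  SC-across a a′ z≢z′ sw sx with avoid⊎reach _ sx
  ... | inj₁ r = step (λ u≡w → SC-≢ sw (sym u≡w)) a′ (mapʷ proj₂ r)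
  ... | inj₂ r = ⊥-elim (neighbours-separated a a′ z≢z′ (SC-trans sw (SC-sym r)))

  side-nested : ∀ {v w w₁ x} → A v w → A w w₁ → w₁ ≢ v → SC w w₁ x → SC v w x
  side-nested a a₁ w₁≢v = SC-across (A-sym a) a₁ (λ v≡w₁ → w₁≢v (sym v≡w₁)) (SC-refl (A-irrefl a))

  side-descend : ∀ {v w x} → A v w → SC v w x → x ≢ w → ∃[ z ] A w z × z ≢ v × SC w z x
  side-descend a s x≢w with avoid⊎leave _ s x≢w
  ... | inj₁ r = ⊥-elim (proj₂ (head-ok r) refl)
  ... | inj₂ (z , az , r) = z , az , proj₁ (head-ok r) , mapʷ proj₂ r

  allV : List V
  allV = allVtx n k

  ∈-allV : ∀ v → v ∈ allV
  ∈-allV (inj₁ i) = ∈-++⁺ˡ (∈-map⁺ inj₁ (∈-allFin i))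
  ∈-allV (inj₂ i) = ∈-++⁺ʳ (map inj₁ (allFin n)) (∈-map⁺ inj₂ (∈-allFin i))

  allV-unique : Unique allV
  allV-unique = ++⁺ (map⁺ Sum.inj₁-injective (allFin⁺ n)) (map⁺ Sum.inj₂-injective (allFin⁺ k)) disjoint
    where
    disjoint : ∀ {v} → ¬ (v ∈ map inj₁ (allFin n) × v ∈ map inj₂ (allFin k))
    disjoint (m₁ , m₂) with ∈-map⁻ inj₁ m₁ | ∈-map⁻ inj₂ m₂
    ... | _ , _ , refl | _ , _ , ()

  neighbours : V → List V
  neighbours u = filter (λ w → T? (adj u w)) allV

  ∈-neighbours⁺ : ∀ {u z} → A u z → z ∈ neighbours u
  ∈-neighbours⁺ {u} {z} = ∈-filter⁺ (λ w → T? (adj u w)) (∈-allV z)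

  ∈-neighbours⁻ : ∀ {u z} → z ∈ neighbours u → A u z
  ∈-neighbours⁻ {u} m = proj₂ (∈-filter⁻ (λ w → T? (adj u w)) {xs = allV} m)

  length-neighbours : ∀ u → length (neighbours u) ≡ deg adj u
  length-neighbours u = sym (count allV)
    where
    count : ∀ L → sum (map (λ w → if adj u w then 1 else 0) L) ≡ length (filter (λ w → T? (adj u w)) L)
    count [] = refl
    count (w ∷ L) with adj u w
    ... | true = cong suc (count L)
    ... | false = count L

  leaf-neighbour : ∀ x → ∃[ p ] A (inj₁ x) p × (∀ {z} → A (inj₁ x) z → z ≡ p)
  leaf-neighbour x =
    let p , p∈ = nonempty-∈ length≡1
    in p , ∈-neighbours⁻ p∈ , λ az → length≡1⇒≡ length≡1 (∈-neighbours⁺ az) p∈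
    where
    length≡1 : length (neighbours (inj₁ x)) ≡ 1
    length≡1 = trans (length-neighbours (inj₁ x)) (leaf-deg x)

  record OtherNeighbours (v w : V) : Set where
    field
      w₁ w₂ : V
      adj₁ : A v w₁
      adj₂ : A v w₂
      w₁≢w₂ : w₁ ≢ w₂
      w₁≢w : w₁ ≢ w
      w₂≢w : w₂ ≢ w
      complete : ∀ {z} → A v z → z ≡ w ⊎ z ≡ w₁ ⊎ z ≡ w₂

  others : ∀ {i w} → A (inj₂ i) w → OtherNeighbours (inj₂ i) w
  others {i} {w} a = two (Lⱽ.remove w (neighbours v)) length≡2 (Lⱽ.remove⁺ neighbours-unique)
                         Lⱽ.∈-remove⁻ (λ a′ z≢w → Lⱽ.∈-remove⁺ (∈-neighbours⁺ a′) z≢w)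
    where
    v : V
    v = inj₂ i
    neighbours-unique : Unique (neighbours v)
    neighbours-unique = filter⁺ (λ z → T? (adj v z)) allV-unique
    length≡2 : length (Lⱽ.remove w (neighbours v)) ≡ 2
    length≡2 = cong pred (trans (Lⱽ.length-remove neighbours-unique (∈-neighbours⁺ a))
                                (trans (length-neighbours v) (int-deg i)))
    two : ∀ L → length L ≡ 2 → Unique L → (∀ {z} → z ∈ L → z ∈ neighbours v × z ≢ w) →
          (∀ {z} → A v z → z ≢ w → z ∈ L) → OtherNeighbours v w
    two (w₁ ∷ w₂ ∷ []) _ ((w₁≢w₂ ∷ []) ∷ [] ∷ []) sound complete′ = record
      { w₁ = w₁ ; w₂ = w₂
      ; adj₁ = ∈-neighbours⁻ (proj₁ (sound (here refl)))
      ; adj₂ = ∈-neighbours⁻ (proj₁ (sound (there (here refl))))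
      ; w₁≢w₂ = w₁≢w₂
      ; w₁≢w = proj₂ (sound (here refl))
      ; w₂≢w = proj₂ (sound (there (here refl)))
      ; complete = complete }
      where
      complete : ∀ {z} → A v z → z ≡ w ⊎ z ≡ w₁ ⊎ z ≡ w₂
      complete {z} a′ with z ≟ⱽ w
      ... | yes z≡w = inj₁ z≡w
      ... | no z≢w with complete′ a′ z≢w
      ... | here z≡w₁ = inj₂ (inj₁ z≡w₁)
      ... | there (here z≡w₂) = inj₂ (inj₂ z≡w₂)

  some-neighbour : ∀ i → ∃[ w ] A (inj₂ i) w
  some-neighbour i =
    let w , w∈ = nonempty-∈ (trans (length-neighbours (inj₂ i)) (int-deg i)) in w , ∈-neighbours⁻ w∈

  side? : ∀ {v w} → A v w → Decidable (SC v w)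
  side? {v} {w} a x with x ≟ⱽ v
  ... | yes refl = no (λ s → SC-≢ s refl)
  ... | no x≢v with sideOf v x x≢v
  ... | z , az , s with z ≟ⱽ w
  ... | yes refl = yes s
  ... | no z≢w = no (λ s′ → neighbours-separated az a z≢w (SC-trans s (SC-sym s′)))

  sideSize : ∀ {v w} → A v w → ℕ
  sideSize a = length (filter (side? a) allV)

  sideSize-nested : ∀ {v w w₁} (a : A v w) (a₁ : A w w₁) → w₁ ≢ v → sideSize a₁ < sideSize a
  sideSize-nested {v} {w} a a₁ w₁≢v =
    Lⱽ.unique∧⊆⇒length≤ (w∉ ∷ filter⁺ (side? a₁) allV-unique) ⊆side
    where
    w∉ : All (w ≢_) (filter (side? a₁) allV)
    w∉ = All.tabulate (λ m w≡ → SC-≢ (proj₂ (∈-filter⁻ (side? a₁) {xs = allV} m)) (sym w≡))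
    ⊆side : w ∷ filter (side? a₁) allV ⊆ filter (side? a) allV
    ⊆side (here refl) = ∈-filter⁺ (side? a) (∈-allV w) (SC-refl (λ w≡v → A-irrefl a (sym w≡v)))
    ⊆side (there m) = ∈-filter⁺ (side? a) (∈-allV _)
                        (side-nested a a₁ w₁≢v (proj₂ (∈-filter⁻ (side? a₁) {xs = allV} m)))

  side-leaf : ∀ {v w} (a : A v w) → ∃[ y ] SC v w (inj₁ y)
  side-leaf a = go a (<-wellFounded (sideSize a))
    where
    go : ∀ {v w} (a : A v w) → Acc _<_ (sideSize a) → ∃[ y ] SC v w (inj₁ y)
    go {w = inj₁ y} a _ = y , SC-refl (λ w≡v → A-irrefl a (sym w≡v))
    go {w = inj₂ i} a (acc rec) =
      let open OtherNeighbours (others (A-sym a))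
          y , s = go adj₁ (rec (sideSize-nested a adj₁ w₁≢w))
      in y , side-nested a adj₁ w₁≢w s

  leaf-side : ∀ {v y y′} → A v (inj₁ y) → SC v (inj₁ y) (inj₁ y′) → y′ ≡ y
  leaf-side {v} {y} {y′} a s with y′ Fin.≟ y
  ... | yes y′≡y = y′≡y
  ... | no y′≢y with side-descend a s (λ { refl → y′≢y refl }) | leaf-neighbour y
  ... | z , az , z≢v , _ | p , _ , only-p = ⊥-elim (z≢v (trans (only-p az) (sym (only-p (A-sym a)))))

  leaf≢interior : ∀ {y i} → _≢_ {A = V} (inj₁ y) (inj₂ i)
  leaf≢interior ()

  Separated : Fin k → Fin n → Fin n → Fin n → Set
  Separated i x y z =
    ¬ SC (inj₂ i) (inj₁ x) (inj₁ y) × ¬ SC (inj₂ i) (inj₁ x) (inj₁ z) × ¬ SC (inj₂ i) (inj₁ y) (inj₁ z)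

  SC-leaves : ∀ {i x y} → x ≡ y → SC (inj₂ i) (inj₁ x) (inj₁ y)
  SC-leaves refl = SC-refl leaf≢interior

  separated⇒≢ : ∀ {i x y} → ¬ SC (inj₂ i) (inj₁ x) (inj₁ y) → x ≢ y
  separated⇒≢ sep x≡y = sep (SC-leaves x≡y)

  sides⇒separated : ∀ {i z₁ z₂ z₃ x y z} → A (inj₂ i) z₁ → A (inj₂ i) z₂ → A (inj₂ i) z₃ →
    z₁ ≢ z₂ → z₁ ≢ z₃ → z₂ ≢ z₃ →
    SC (inj₂ i) z₁ (inj₁ x) → SC (inj₂ i) z₂ (inj₁ y) → SC (inj₂ i) z₃ (inj₁ z) → Separated i x y z
  sides⇒separated a₁ a₂ a₃ z₁≢z₂ z₁≢z₃ z₂≢z₃ s₁ s₂ s₃ =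
    sides-separated a₁ a₂ z₁≢z₂ s₁ s₂ ,
    sides-separated a₁ a₃ z₁≢z₃ s₁ s₃ ,
    sides-separated a₂ a₃ z₂≢z₃ s₂ s₃

  -- pigeonhole: x, y, z lie in three distinct branches at i
  separated-meets : ∀ {i w x y z} → A (inj₂ i) w → Separated i x y z →
    SC (inj₂ i) w (inj₁ x) ⊎ SC (inj₂ i) w (inj₁ y) ⊎ SC (inj₂ i) w (inj₁ z)
  separated-meets {i} {w} {x} {y} {z} a (sxy , sxz , syz)
    with sideOf _ (inj₁ x) leaf≢interior | sideOf _ (inj₁ y) leaf≢interior | sideOf _ (inj₁ z) leaf≢interior
  ... | zx , ax , sx | zy , ay , sy | zz , az , sz with zx ≟ⱽ w | zy ≟ⱽ w | zz ≟ⱽ w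
  ... | yes refl | _ | _ = inj₁ sx
  ... | no _ | yes refl | _ = inj₂ (inj₁ sy)
  ... | no _ | no _ | yes refl = inj₂ (inj₂ sz)
  ... | no zx≢w | no zy≢w | no zz≢w =
    ⊥-elim (3≰2 (Lⱽ.distinct-∈⇒3≤length (apart sx sy sxy) (apart sx sz sxz) (apart sy sz syz)
                                          (other ax zx≢w) (other ay zy≢w) (other az zz≢w)))
    where
    open OtherNeighbours (others a)
    apart : ∀ {u v p q} → SC (inj₂ i) u (inj₁ p) → SC (inj₂ i) v (inj₁ q) →
            ¬ SC (inj₂ i) (inj₁ p) (inj₁ q) → u ≢ v
    apart s t sep refl = sep (SC-trans (SC-sym s) t)
    other : ∀ {u} → A (inj₂ i) u → u ≢ w → u ∈ w₁ ∷ w₂ ∷ []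
    other au u≢w with complete au
    ... | inj₁ u≡w = ⊥-elim (u≢w u≡w)
    ... | inj₂ (inj₁ u≡w₁) = here u≡w₁
    ... | inj₂ (inj₂ u≡w₂) = there (here u≡w₂)

  -- i is an interior vertex of the subtree spanned by the leaves in Y
  Median : List (Fin n) → Fin k → Set
  Median Y i = ∀ {z} → A (inj₂ i) z → ∃[ y ] y ∈ Y × SC (inj₂ i) z (inj₁ y)

  Cover : List (Fin n) → List Pair → Set
  Cover Y E = ∀ i → Median Y i →
    ∃[ x ] ∃[ y ] ∃[ z ] (x ∈ Y × y ∈ Y × z ∈ Y) × Separated i x y z × Triangle E x y z

  record Cherry (Y : List (Fin n)) : Set where
    field
      u : Fin k
      wᶜ : V
      adjᶜ : A (inj₂ u) wᶜ
      branches : OtherNeighbours (inj₂ u) wᶜ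
    open OtherNeighbours branches public
    field
      a b c : Fin n
      a∈Y : a ∈ Y
      b∈Y : b ∈ Y
      c∈Y : c ∈ Y
      a-side : SC (inj₂ u) w₁ (inj₁ a)
      b-side : SC (inj₂ u) w₂ (inj₁ b)
      c-side : SC (inj₂ u) wᶜ (inj₁ c)
      a-alone : ∀ {y} → y ∈ Y → SC (inj₂ u) w₁ (inj₁ y) → y ≡ a
      b-alone : ∀ {y} → y ∈ Y → SC (inj₂ u) w₂ (inj₁ y) → y ≡ b

  module _ {Y : List (Fin n)} where

    alone-∈-triple : ∀ {v z q x y y′} → (∀ {t} → t ∈ Y → SC v z (inj₁ t) → t ≡ q) → x ∈ Y → y ∈ Y → y′ ∈ Y →
      SC v z (inj₁ x) ⊎ SC v z (inj₁ y) ⊎ SC v z (inj₁ y′) → q ∈ x ∷ y ∷ y′ ∷ []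
    alone-∈-triple alone x∈Y _ _ (inj₁ s) = here (sym (alone x∈Y s))
    alone-∈-triple alone _ y∈Y _ (inj₂ (inj₁ s)) = there (here (sym (alone y∈Y s)))
    alone-∈-triple alone _ _ y′∈Y (inj₂ (inj₂ s)) = there (there (here (sym (alone y′∈Y s))))

    alone⊎partner : ∀ {v z} (a : A v z) y →
      (∀ {y′} → y′ ∈ Y → SC v z (inj₁ y′) → y′ ≡ y) ⊎ ∃[ y′ ] y′ ∈ Y × y ≢ y′ × SC v z (inj₁ y′)
    alone⊎partner {v} {z} a y with any? (λ y′ → ¬? (y Fin.≟ y′) ×-dec side? a (inj₁ y′)) Y
    ... | yes partner = inj₂ (find partner)
    ... | no ¬partner = inj₁ alone
      where
      alone : ∀ {y′} → y′ ∈ Y → SC v z (inj₁ y′) → y′ ≡ y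
      alone {y′} m s with y Fin.≟ y′
      ... | yes y≡y′ = sym y≡y′
      ... | no y≢y′ = ⊥-elim (¬partner (lose m (y≢y′ , s)))

    branch-of : ∀ {v i y} → A v (inj₂ i) → (o : OtherNeighbours (inj₂ i) v) → SC v (inj₂ i) (inj₁ y) →
      SC (inj₂ i) (OtherNeighbours.w₁ o) (inj₁ y) ⊎ SC (inj₂ i) (OtherNeighbours.w₂ o) (inj₁ y)
    branch-of a o s with side-descend a s leaf≢interior
    ... | z , az , z≢v , s′ with OtherNeighbours.complete o az
    ... | inj₁ z≡v = ⊥-elim (z≢v z≡v)
    ... | inj₂ (inj₁ refl) = inj₁ s′
    ... | inj₂ (inj₂ refl) = inj₂ s′

    module _ (uY : Unique Y) (3≤|Y| : 3 ≤ length Y) where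

      cherry-at : ∀ {v i} → A v (inj₂ i) → (o : OtherNeighbours (inj₂ i) v) → ∀ {p q} → p ∈ Y → q ∈ Y →
        SC (inj₂ i) (OtherNeighbours.w₁ o) (inj₁ p) → SC (inj₂ i) (OtherNeighbours.w₂ o) (inj₁ q) →
        (∀ {y} → y ∈ Y → SC (inj₂ i) (OtherNeighbours.w₁ o) (inj₁ y) → y ≡ p) →
        (∀ {y} → y ∈ Y → SC (inj₂ i) (OtherNeighbours.w₂ o) (inj₁ y) → y ≡ q) → Cherry Y
      cherry-at {v} {i} a o {p} {q} p∈Y q∈Y p-side q-side p-alone q-alone with avoiding-two uY 3≤|Y| p q
      ... | c , c∈Y , c≢p , c≢q = record
        { u = i ; wᶜ = v ; adjᶜ = A-sym a ; branches = o
        ; a = p ; b = q ; c = c ; a∈Y = p∈Y ; b∈Y = q∈Y ; c∈Y = c∈Y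
        ; a-side = p-side ; b-side = q-side ; c-side = c-side
        ; a-alone = p-alone ; b-alone = q-alone }
        where
        c-side : SC (inj₂ i) v (inj₁ c)
        c-side with sideOf (inj₂ i) (inj₁ c) leaf≢interior
        ... | z , az , s with OtherNeighbours.complete o az
        ... | inj₁ refl = s
        ... | inj₂ (inj₁ refl) = ⊥-elim (c≢p (p-alone c∈Y s))
        ... | inj₂ (inj₂ refl) = ⊥-elim (c≢q (q-alone c∈Y s))

      -- walk away from v, always into a branch still holding two leaves of Y; the side shrinks
      cherry-in-side : ∀ {v w} (a : A v w) → Acc _<_ (sideSize a) → ∀ {y₁ y₂} → y₁ ≢ y₂ → y₁ ∈ Y → y₂ ∈ Y →
        SC v w (inj₁ y₁) → SC v w (inj₁ y₂) → Cherry Y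
      cherry-in-side {w = inj₁ _} a _ y₁≢y₂ _ _ s₁ s₂ =
        ⊥-elim (y₁≢y₂ (trans (leaf-side a s₁) (sym (leaf-side a s₂))))
      cherry-in-side {v} {inj₂ i} a (acc rec) {y₁} {y₂} y₁≢y₂ m₁ m₂ s₁ s₂ =
        by-branch (branch-of a o s₁) (branch-of a o s₂)
        where
        o : OtherNeighbours (inj₂ i) v
        o = others (A-sym a)
        open OtherNeighbours o
        Descend : V → Set
        Descend w = ∀ {p q} → p ≢ q → p ∈ Y → q ∈ Y → SC (inj₂ i) w (inj₁ p) → SC (inj₂ i) w (inj₁ q) → Cherry Y
        descend₁ : Descend w₁
        descend₁ = cherry-in-side adj₁ (rec (sideSize-nested a adj₁ w₁≢w))
        descend₂ : Descend w₂
        descend₂ = cherry-in-side adj₂ (rec (sideSize-nested a adj₂ w₂≢w))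
        split : ∀ {p q} → p ∈ Y → q ∈ Y → SC (inj₂ i) w₁ (inj₁ p) → SC (inj₂ i) w₂ (inj₁ q) → Cherry Y
        split {p} {q} p∈Y q∈Y tp tq with alone⊎partner adj₁ p | alone⊎partner adj₂ q
        ... | inj₂ (p′ , p′∈Y , p≢p′ , tp′) | _ = descend₁ p≢p′ p∈Y p′∈Y tp tp′
        ... | inj₁ _ | inj₂ (q′ , q′∈Y , q≢q′ , tq′) = descend₂ q≢q′ q∈Y q′∈Y tq tq′
        ... | inj₁ p-alone | inj₁ q-alone = cherry-at a o p∈Y q∈Y tp tq p-alone q-alone
        by-branch : SC (inj₂ i) w₁ (inj₁ y₁) ⊎ SC (inj₂ i) w₂ (inj₁ y₁) →
                    SC (inj₂ i) w₁ (inj₁ y₂) ⊎ SC (inj₂ i) w₂ (inj₁ y₂) → Cherry Y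
        by-branch (inj₁ t₁) (inj₁ t₂) = descend₁ y₁≢y₂ m₁ m₂ t₁ t₂
        by-branch (inj₂ t₁) (inj₂ t₂) = descend₂ y₁≢y₂ m₁ m₂ t₁ t₂
        by-branch (inj₁ t₁) (inj₂ t₂) = split m₁ m₂ t₁ t₂
        by-branch (inj₂ t₁) (inj₁ t₂) = split m₂ m₁ t₂ t₁

      cherry : Cherry Y
      cherry with three-distinct uY 3≤|Y|
      ... | y₀ , y₁ , y₂ , (_ , m₁ , m₂) , y₀≢y₁ , y₀≢y₂ , y₁≢y₂ with leaf-neighbour y₀
      ... | p , ap , only-p = cherry-in-side ap (<-wellFounded _) y₁≢y₂ m₁ m₂ (away y₀≢y₁) (away y₀≢y₂)
        where
        away : ∀ {y} → y₀ ≢ y → SC (inj₁ y₀) p (inj₁ y)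
        away y₀≢y with sideOf (inj₁ y₀) (inj₁ _) (λ { refl → y₀≢y refl })
        ... | z , az , s with only-p az
        ... | refl = s

  record Construction (Y : List (Fin n)) : Set where
    field
      pairs : List Pair
      ordered : All Ordered pairs
      unique : Unique pairs
      within : ∀ {p} → p ∈ pairs → proj₁ p ∈ Y × proj₂ p ∈ Y
      size : 3 + length pairs ≡ 2 * length Y
      neighbour : ∀ {y} → y ∈ Y → ∃[ z ] z ≢ y × Edge pairs y z
      covers : Cover Y pairs

  module Pruning {Y : List (Fin n)} (uY : Unique Y) (ch : Cherry Y) where
    open Cherry ch public

    U : V
    U = inj₂ u

    a≢b : a ≢ b
    a≢b a≡b = sides-separated adj₁ adj₂ w₁≢w₂ a-side b-side (SC-leaves a≡b)

    classify : ∀ {y} → y ∈ Y → y ≡ a ⊎ y ≡ b ⊎ SC U wᶜ (inj₁ y)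
    classify y∈Y with sideOf U (inj₁ _) leaf≢interior
    ... | z , az , s with complete az
    ... | inj₁ refl = inj₂ (inj₂ s)
    ... | inj₂ (inj₁ refl) = inj₁ (a-alone y∈Y s)
    ... | inj₂ (inj₂ refl) = inj₂ (inj₁ (b-alone y∈Y s))

    u-median : Median Y u
    u-median az with complete az
    ... | inj₁ refl = c , c∈Y , c-side
    ... | inj₂ (inj₁ refl) = a , a∈Y , a-side
    ... | inj₂ (inj₂ refl) = b , b∈Y , b-side

    -- the two branches of i away from u would each hold a leaf of Y, and both leaves would be q
    not-in-lone-branch : ∀ {i z q} → i ≢ u → Median Y i → SC U z (inj₂ i) →
      (∀ {y} → y ∈ Y → SC U z (inj₁ y) → y ≡ q) → ⊥
    not-in-lone-branch {i} {z} {q} i≢u med s alone with sideOf (inj₂ i) U (λ { refl → i≢u refl })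
    ... | t , at , st = branches-away (others at)
      where
      towards-q : ∀ {w y} → A (inj₂ i) w → w ≢ t → SC (inj₂ i) w (inj₁ y) → y ∈ Y → y ≡ q
      towards-q aw w≢t sw y∈Y = alone y∈Y (SC-trans s (SC-across at aw (λ t≡w → w≢t (sym t≡w)) st sw))
      branches-away : OtherNeighbours (inj₂ i) t → ⊥
      branches-away o =
        let y₁ , m₁ , s₁ = med O.adj₁
            y₂ , m₂ , s₂ = med O.adj₂
            y₁≡y₂ = trans (towards-q O.adj₁ O.w₁≢w s₁ m₁) (sym (towards-q O.adj₂ O.w₂≢w s₂ m₂))
        in sides-separated O.adj₁ O.adj₂ O.w₁≢w₂ s₁ s₂ (SC-leaves y₁≡y₂)
        where module O = OtherNeighbours o

    a-b-together : ∀ {i} → i ≢ u → Median Y i → SC (inj₂ i) (inj₁ a) (inj₁ b)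
    a-b-together {i} i≢u med with sideOf U (inj₂ i) (λ { refl → i≢u refl })
    ... | z , az , s with complete az
    ... | inj₁ refl = SC-trans (SC-sym (SC-across adjᶜ adj₁ (λ e → w₁≢w (sym e)) s a-side))
                               (SC-across adjᶜ adj₂ (λ e → w₂≢w (sym e)) s b-side)
    ... | inj₂ (inj₁ refl) = ⊥-elim (not-in-lone-branch i≢u med s a-alone)
    ... | inj₂ (inj₂ refl) = ⊥-elim (not-in-lone-branch i≢u med s b-alone)

    Y′ : List (Fin n)
    Y′ = remove a Y

    Y′-unique : Unique Y′
    Y′-unique = remove⁺ uY

    length-Y′ : suc (length Y′) ≡ length Y
    length-Y′ = length-remove uY a∈Y

    b∈Y′ : b ∈ Y′
    b∈Y′ = ∈-remove⁺ b∈Y (λ b≡a → a≢b (sym b≡a))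

    ∈-Y′⁻ : ∀ {y} → y ∈ Y′ → y ∈ Y × y ≢ a
    ∈-Y′⁻ = ∈-remove⁻ {xs = Y}

    Y′⊆Y : Y′ ⊆ Y
    Y′⊆Y m = proj₁ (∈-Y′⁻ m)

    median-prune : ∀ {i} → i ≢ u → Median Y i → Median Y′ i
    median-prune {i} i≢u med az with med az
    ... | y , y∈Y , s with y Fin.≟ a
    ... | yes refl = b , b∈Y′ , SC-trans s (a-b-together i≢u med)
    ... | no y≢a = y , ∈-remove⁺ y∈Y y≢a , s

    median-unprune : ∀ {i} → Median Y′ i → Median Y i
    median-unprune med az = let y , m , s = med az in y , Y′⊆Y m , s

    median-pruned-≢u : ∀ {i} → Median Y′ i → i ≢ u
    median-pruned-≢u med refl = let y , m , s = med adj₁ ; y∈Y , y≢a = ∈-Y′⁻ m in y≢a (a-alone y∈Y s)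

    cherry-triangle : ∀ {E} → Cover Y E → ∃[ c′ ] c′ ≢ a × c′ ≢ b × Triangle E a b c′
    cherry-triangle cover with cover u u-median
    ... | x , y , z , (x∈Y , y∈Y , z∈Y) , sep@(sxy , sxz , syz) , t =
      triangle-through t (separated⇒≢ sxy) (separated⇒≢ sxz) (separated⇒≢ syz)
        (alone-∈-triple a-alone x∈Y y∈Y z∈Y (separated-meets adj₁ sep))
        (alone-∈-triple b-alone x∈Y y∈Y z∈Y (separated-meets adj₂ sep)) a≢b

    module Collapse {E : List Pair} (cover : Cover Y E) {c′ : Fin n} (c′≢a : c′ ≢ a) (c′≢b : c′ ≢ b)
                    (edge-ab : Edge E a b) (edge-ac′ : Edge E a c′) (edge-bc′ : Edge E b c′) where

      merge : Fin n → Fin n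
      merge x with x Fin.≟ a
      ... | yes _ = b
      ... | no _ = x

      merge-a : merge a ≡ b
      merge-a with a Fin.≟ a
      ... | yes _ = refl
      ... | no a≢a = ⊥-elim (a≢a refl)

      merge-≢a : ∀ {x} → x ≢ a → merge x ≡ x
      merge-≢a {x} x≢a with x Fin.≟ a
      ... | yes x≡a = ⊥-elim (x≢a x≡a)
      ... | no _ = refl

      merge-∈ : ∀ {x} → x ∈ Y → merge x ∈ Y′
      merge-∈ {x} x∈Y with x Fin.≟ a
      ... | yes _ = b∈Y′
      ... | no x≢a = ∈-remove⁺ x∈Y x≢a

      merge-together : ∀ {i} → i ≢ u → Median Y i → ∀ x → SC (inj₂ i) (inj₁ (merge x)) (inj₁ x)
      merge-together i≢u med x with x Fin.≟ a
      ... | yes refl = SC-sym (a-b-together i≢u med)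
      ... | no _ = SC-refl leaf≢interior

      E₋ : List Pair
      E₋ = removeEdge a c′ E

      E₊ : List Pair
      E₊ = map (mapPair merge) E₋

      E′ : List Pair
      E′ = dropLoops E₊

      removeEdge-ab : Edge E₋ a b
      removeEdge-ab = Edge-removeEdge edge-ab (λ isP → c′≢b (IsPair-unique isP (inj₁ refl)))

      removeEdge-bc′ : Edge E₋ b c′
      removeEdge-bc′ = Edge-removeEdge edge-bc′ (λ isP → a≢b (IsPair-unique (IsPair-sym isP) (inj₂ refl)))

      merge-b≡merge-a : merge b ≡ merge a
      merge-b≡merge-a = trans (merge-≢a (λ b≡a → a≢b (sym b≡a))) (sym merge-a)

      E′-ac′ : merge a ≢ merge c′ → Edge E′ (merge a) (merge c′)
      E′-ac′ = Edge-dropLoops (subst (λ t → Edge E₊ t (merge c′)) merge-b≡merge-a (Edge-map merge removeEdge-bc′))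

      E′-merge : ∀ {x y} → Edge E x y → merge x ≢ merge y → Edge E′ (merge x) (merge y)
      E′-merge {x} {y} e mx≢my with isPair? a c′ (x , y)
      ... | no ¬ac′ = Edge-dropLoops (Edge-map merge (Edge-removeEdge e ¬ac′)) mx≢my
      ... | yes (inj₁ refl) = E′-ac′ mx≢my
      ... | yes (inj₂ refl) = Edge-sym (E′-ac′ (λ e → mx≢my (sym e)))

      length-E′ : 2 + length E′ ≤ length E
      length-E′ = ≤-trans (s≤s (≤-trans dropped (≤-reflexive (length-map (mapPair merge) E₋))))
                          (length-removeEdge< edge-ac′)
        where
        dropped : length E′ < length E₊
        dropped = length-dropLoops< (subst (λ t → Edge E₊ t (merge b)) (sym merge-b≡merge-a) (Edge-map merge removeEdge-ab))

      E′-nonempty : 0 < length E′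
      E′-nonempty = ∈-length (proj₁ (proj₂ (Edge-witness (E′-ac′ merge-a≢merge-c′))))
        where
        merge-a≢merge-c′ : merge a ≢ merge c′
        merge-a≢merge-c′ e = c′≢b (sym (trans (sym merge-a) (trans e (merge-≢a c′≢a))))

      E′-cover : Cover Y′ E′
      E′-cover i med′ with cover i (median-unprune med′)
      ... | x , y , z , (x∈Y , y∈Y , z∈Y) , (sxy , sxz , syz) , (exy , exz , eyz) =
        merge x , merge y , merge z , (merge-∈ x∈Y , merge-∈ y∈Y , merge-∈ z∈Y) , (keep sxy , keep sxz , keep syz)
          , (E′-merge exy (separated⇒≢ (keep sxy)) , E′-merge exz (separated⇒≢ (keep sxz))
            , E′-merge eyz (separated⇒≢ (keep syz)))
        where
        together : ∀ x → SC (inj₂ i) (inj₁ (merge x)) (inj₁ x)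
        together = merge-together (median-pruned-≢u med′) (median-unprune med′)
        keep : ∀ {p q} → ¬ SC (inj₂ i) (inj₁ p) (inj₁ q) → ¬ SC (inj₂ i) (inj₁ (merge p)) (inj₁ (merge q))
        keep {p} {q} sep s = sep (SC-trans (SC-sym (together p)) (SC-trans s (together q)))

    collapse : ∀ {E} → Cover Y E → ∃[ E′ ] Cover Y′ E′ × 2 + length E′ ≤ length E × 0 < length E′
    collapse cover with cherry-triangle cover
    ... | c′ , c′≢a , c′≢b , (edge-ab , edge-ac′ , edge-bc′) = E′ , E′-cover , length-E′ , E′-nonempty
      where open Collapse cover c′≢a c′≢b edge-ab edge-ac′ edge-bc′

    module Extension (C : Construction Y′) where
      open Construction C
        renaming (pairs to E′; ordered to ordered′; unique to unique′; within to within′; size to size′;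
                  neighbour to neighbour′; covers to covers′)

      c′ : Fin n
      c′ = proj₁ (neighbour′ b∈Y′)

      c′≢b : c′ ≢ b
      c′≢b = proj₁ (proj₂ (neighbour′ b∈Y′))

      edge-bc′ : Edge E′ b c′
      edge-bc′ = proj₂ (proj₂ (neighbour′ b∈Y′))

      c′∈Y′ : c′ ∈ Y′
      c′∈Y′ with edge-bc′
      ... | inj₁ m = proj₂ (within′ m)
      ... | inj₂ m = proj₁ (within′ m)

      c′≢a : c′ ≢ a
      c′≢a = proj₂ (∈-Y′⁻ c′∈Y′)

      c′-side : SC U wᶜ (inj₁ c′)
      c′-side with classify (Y′⊆Y c′∈Y′)
      ... | inj₁ c′≡a = ⊥-elim (c′≢a c′≡a)
      ... | inj₂ (inj₁ c′≡b) = ⊥-elim (c′≢b c′≡b)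
      ... | inj₂ (inj₂ s) = s

      E : List Pair
      E = norm a b ∷ norm a c′ ∷ E′

      edge-ab : Edge E a b
      edge-ab = Edge-isPair (here refl) (norm-isPair a b)

      edge-ac′ : Edge E a c′
      edge-ac′ = Edge-isPair (there (here refl)) (norm-isPair a c′)

      lift : ∀ {x y} → Edge E′ x y → Edge E x y
      lift = Edge-mono (λ m → there (there m))

      a-free : ∀ {p x} → p ∈ E′ → ¬ IsPair p a x
      a-free m (inj₁ refl) = proj₂ (∈-Y′⁻ (proj₁ (within′ m))) refl
      a-free m (inj₂ refl) = proj₂ (∈-Y′⁻ (proj₂ (within′ m))) refl

      fresh : ∀ x → All (norm a x ≢_) E′
      fresh x = All.tabulate (λ m e → a-free m (subst (λ p → IsPair p a x) e (norm-isPair a x)))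

      ab≢ac′ : norm a b ≢ norm a c′
      ab≢ac′ e = c′≢b (sym (IsPair-unique (norm-isPair a b) (subst (λ p → IsPair p a c′) (sym e) (norm-isPair a c′))))

      E-within : ∀ {p} → p ∈ E → proj₁ p ∈ Y × proj₂ p ∈ Y
      E-within (here refl) = IsPair-∈ (norm-isPair a b) a∈Y b∈Y
      E-within (there (here refl)) = IsPair-∈ (norm-isPair a c′) a∈Y (Y′⊆Y c′∈Y′)
      E-within (there (there m)) = Y′⊆Y (proj₁ (within′ m)) , Y′⊆Y (proj₂ (within′ m))

      E-neighbour : ∀ {y} → y ∈ Y → ∃[ z ] z ≢ y × Edge E y z
      E-neighbour {y} y∈Y with y Fin.≟ a
      ... | yes refl = b , (λ b≡a → a≢b (sym b≡a)) , edge-ab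
      ... | no y≢a = let z , z≢y , e = neighbour′ (∈-remove⁺ y∈Y y≢a) in z , z≢y , lift e

      E-covers : Cover Y E
      E-covers i med with i Fin.≟ u
      ... | yes refl =
        a , b , c′ , (a∈Y , b∈Y , Y′⊆Y c′∈Y′)
          , sides⇒separated adj₁ adj₂ adjᶜ w₁≢w₂ w₁≢w w₂≢w a-side b-side c′-side
          , (edge-ab , edge-ac′ , lift edge-bc′)
      ... | no i≢u =
        let x , y , z , (x∈ , y∈ , z∈) , sep , (exy , exz , eyz) = covers′ i (median-prune i≢u med)
        in x , y , z , (Y′⊆Y x∈ , Y′⊆Y y∈ , Y′⊆Y z∈) , sep , (lift exy , lift exz , lift eyz)

      extend : Construction Y
      extend = record
        { pairs = E
        ; ordered = norm-ordered a≢b ∷ norm-ordered (λ a≡c′ → c′≢a (sym a≡c′)) ∷ ordered′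
        ; unique = (ab≢ac′ ∷ fresh b) ∷ fresh c′ ∷ unique′
        ; within = E-within
        ; size = trans (cong (2 +_) size′) (trans (sym (*-suc 2 (length Y′))) (cong (2 *_) length-Y′))
        ; neighbour = E-neighbour
        ; covers = E-covers }

    extend : Construction Y′ → Construction Y
    extend = Extension.extend

  median⇒3≤length : ∀ {Y i} → Median Y i → 3 ≤ length Y
  median⇒3≤length {Y} {i} med =
    let w , aw = some-neighbour i
        open OtherNeighbours (others aw)
        y₀ , m₀ , s₀ = med aw
        y₁ , m₁ , s₁ = med adj₁
        y₂ , m₂ , s₂ = med adj₂
        s₀₁ , s₀₂ , s₁₂ = sides⇒separated aw adj₁ adj₂ (λ e → w₁≢w (sym e)) (λ e → w₂≢w (sym e)) w₁≢w₂ s₀ s₁ s₂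
    in distinct-∈⇒3≤length (separated⇒≢ s₀₁) (separated⇒≢ s₀₂) (separated⇒≢ s₁₂) m₀ m₁ m₂

  lower-bound : ∀ m {Y E} → Unique Y → length Y ≡ 3 + m → Cover Y E → 2 * length Y ≤ 3 + length E
  lower-bound m {Y} {E} uY |Y|≡ cover = by-collapse (collapse cover)
    where
    open Pruning uY (cherry uY (subst (3 ≤_) (sym |Y|≡) (m≤m+n 3 m)))
    |Y′|≡ : length Y′ ≡ 2 + m
    |Y′|≡ = cong pred (trans length-Y′ |Y|≡)
    by-collapse : ∃[ E′ ] Cover Y′ E′ × 2 + length E′ ≤ length E × 0 < length E′ → 2 * length Y ≤ 3 + length E
    by-collapse (E′ , cover′ , shrink , nonempty) =
      subst (λ l → 2 * l ≤ 3 + length E) length-Y′ (double-suc-≤ (bound-Y′ m |Y′|≡) shrink)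
      where
      bound-Y′ : ∀ m → length Y′ ≡ 2 + m → 2 * length Y′ ≤ 3 + length E′
      bound-Y′ zero |Y′|≡2 = subst (λ l → 2 * l ≤ 3 + length E′) (sym |Y′|≡2) (+-monoʳ-≤ 3 nonempty)
      bound-Y′ (suc m′) |Y′|≡ = lower-bound m′ Y′-unique |Y′|≡ cover′

  construct : ∀ m {Y} → Unique Y → length Y ≡ 2 + m → Construction Y
  construct zero {y₁ ∷ y₂ ∷ []} uY@((y₁≢y₂ ∷ []) ∷ [] ∷ []) refl = record
    { pairs = norm y₁ y₂ ∷ []
    ; ordered = norm-ordered y₁≢y₂ ∷ []
    ; unique = [] ∷ []
    ; within = λ { (here refl) → IsPair-∈ (norm-isPair y₁ y₂) (here refl) (there (here refl)) }
    ; size = refl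
    ; neighbour = λ { (here refl) → y₂ , (λ e → y₁≢y₂ (sym e)) , edge
                    ; (there (here refl)) → y₁ , y₁≢y₂ , Edge-sym edge }
    ; covers = λ i med → ⊥-elim (3≰2 (median⇒3≤length med)) }
    where
    edge : Edge (norm y₁ y₂ ∷ []) y₁ y₂
    edge = Edge-isPair (here refl) (norm-isPair y₁ y₂)
  construct (suc m) {Y} uY |Y|≡ = extend (construct m Y′-unique (cong pred (trans length-Y′ |Y|≡)))
    where open Pruning uY (cherry uY (subst (3 ≤_) (sym |Y|≡) (m≤m+n 3 m)))

proposition3 : (n : ℕ) → 3 ≤ n → (k : ℕ) → (Tr : BinPhyloTree n k) →
    ((𝒯 : PairSet n) → TripletCover Tr 𝒯 → 2 * n ∸ 3 ≤ PairSet.card 𝒯)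
    × Σ (PairSet n) (λ 𝒯 → TripletCover Tr 𝒯 × PairSet.card 𝒯 ≡ 2 * n ∸ 3)
proposition3 n 3≤n k Tr = lower , upper
  where
  length-X : length (allFin n) ≡ n
  length-X = length-tabulate (λ i → i)

  lower : (𝒯 : PairSet n) → TripletCover Tr 𝒯 → 2 * n ∸ 3 ≤ PairSet.card 𝒯
  lower 𝒯 tc = m≤n+o⇒m∸n≤o (2 * n) 3 (subst (λ l → 2 * l ≤ 3 + PairSet.card 𝒯) length-X
    (lower-bound Tr (n ∸ 3) (allFin⁺ n) (trans length-X (sym (m+[n∸m]≡n 3≤n))) cover))
    where
    cover : Cover Tr (allFin n) (PairSet.pairs 𝒯)
    cover i _ = let x , y , z , (s₁ , s₂ , s₃ , e₁ , e₂ , e₃) = tc i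
                in x , y , z , (∈-allFin x , ∈-allFin y , ∈-allFin z) , (s₁ , s₂ , s₃) , (e₁ , e₂ , e₃)

  upper : Σ (PairSet n) (λ 𝒯 → TripletCover Tr 𝒯 × PairSet.card 𝒯 ≡ 2 * n ∸ 3)
  upper = 𝒯 , tc , card≡
    where
    open Construction (construct Tr (n ∸ 2) (allFin⁺ n) (trans length-X (sym (m+[n∸m]≡n (≤-trans (n≤1+n 2) 3≤n)))))
    𝒯 : PairSet n
    𝒯 = record { pairs = pairs ; ordered = ordered ; unique = unique }
    every-median : ∀ i → Median Tr (allFin n) i
    every-median i az = let y , s = side-leaf Tr az in y , ∈-allFin y , s
    tc : TripletCover Tr 𝒯
    tc i = let x , y , z , _ , (s₁ , s₂ , s₃) , (e₁ , e₂ , e₃) = covers i (every-median i)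
           in x , y , z , (s₁ , s₂ , s₃ , e₁ , e₂ , e₃)
    card≡ : length pairs ≡ 2 * n ∸ 3
    card≡ = begin
      length pairs               ≡⟨ sym (m+n∸m≡n 3 (length pairs)) ⟩
      3 + length pairs ∸ 3       ≡⟨ cong (_∸ 3) size ⟩
      2 * length (allFin n) ∸ 3  ≡⟨ cong (λ l → 2 * l ∸ 3) length-X ⟩
      2 * n ∸ 3                  ∎
      where open ≡-Reasoning
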